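{- Let $G$ and $H$ be graphs, $x$ a vertex of $\mathrm{core}(G)$ and $y$ a vertex of $\mathrm{core}(H)$. Let $C$ be the coloring produced by color refinement run on $G$ and $H$ jointly (or on $G$ alone if $G=H$). If the rooted trees $T_x$ and $T_y$ are not isomorphic, then $C(x)\neq C(y)$.
   Context: The core $\mathrm{core}(G)$ is the maximal subgraph of $G$ with minimum degree at least $2$. For $x\in\mathrm{core}(G)$, $T_x$ is the tree in $G$ rooted at $x$ consisting of $x$ and all vertices reachable from $x$ by paths having no other vertex in $\mathrm{core}(G)$; it shares only $x$ with the core. Color refinement: starting from a uniform coloring of the vertex set (of the disjoint union when two graphs are given), iteratively set $C_i(x)=(C_{i-1}(x),\{\!\{C_{i-1}(y):y\in N(x)\}\!\})$ until the color partition stabilizes, giving $C$. -}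

module Defs where

open import Data.Nat using (ℕ; zero; suc; _+_; _≤_; _≡ᵇ_)
open import Data.Fin using (Fin; splitAt; _↑ˡ_; _↑ʳ_)
open import Data.Fin.Subset using (Subset; _∈_; _∉_; _⊆_; _∩_; ∣_∣)
open import Data.Bool using (Bool; true; false; _∧_)
open import Data.Sum using (_⊎_; inj₁; inj₂)
open import Data.Vec using (tabulate)
open import Data.Product using (Σ; _×_)
open import Relation.Binary.PropositionalEquality using (_≡_)

record Graph : Set where
  field
    n     : ℕ
    adj   : Fin n → Fin n → Bool
    sym   : ∀ u v → adj u v ≡ adj v u
    irrefl : ∀ v → adj v v ≡ false
open Graph public

nbhd : (G : Graph) → Fin (n G) → Subset (n G)
nbhd G v = tabulate (adj G v)

MinDeg2 : (G : Graph) → Subset (n G) → Set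
MinDeg2 G S = ∀ v → v ∈ S → 2 ≤ ∣ nbhd G v ∩ S ∣

IsCore : (G : Graph) → Subset (n G) → Set
IsCore G K = MinDeg2 G K × (∀ S → MinDeg2 G S → S ⊆ K)

-- Vertices of T_x (w.r.t. core K): x, and every vertex reachable from x by a
-- path whose vertices other than x all lie outside the core.
data InTree (G : Graph) (K : Subset (n G)) (x : Fin (n G)) : Fin (n G) → Set where
  root : InTree G K x x
  step : ∀ {u w} → InTree G K x u → adj G u w ≡ true → w ∉ K → InTree G K x w

-- Isomorphism of rooted trees T_x ≅ T_y (T_x is the subgraph of G induced on
-- its vertex set, rooted at x): a bijection between the vertex sets mapping
-- root to root and preserving adjacency and non-adjacency.
record RootedIso (G H : Graph) (KG : Subset (n G)) (KH : Subset (n H))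
                 (x : Fin (n G)) (y : Fin (n H)) : Set where
  field
    to      : Fin (n G) → Fin (n H)
    from    : Fin (n H) → Fin (n G)
    to-in   : ∀ u → InTree G KG x u → InTree H KH y (to u)
    from-in : ∀ v → InTree H KH y v → InTree G KG x (from v)
    from-to : ∀ u → InTree G KG x u → from (to u) ≡ u
    to-from : ∀ v → InTree H KH y v → to (from v) ≡ v
    root↦   : to x ≡ y
    adj-pres : ∀ u v → InTree G KG x u → InTree G KG x v →
               adj G u v ≡ adj H (to u) (to v)

-- Disjoint union of two graphs, vertex set Fin (n G + n H);
-- G-vertices are u ↑ˡ n H, H-vertices are n G ↑ʳ v.
unionAdj : (G H : Graph) → Fin (n G + n H) → Fin (n G + n H) → Bool
unionAdj G H a b with splitAt (n G) a | splitAt (n G) b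
... | inj₁ u | inj₁ v = adj G u v
... | inj₂ u | inj₂ v = adj H u v
... | inj₁ _ | inj₂ _ = false
... | inj₂ _ | inj₁ _ = false

open import Relation.Binary.PropositionalEquality using (refl)

unionSym : (G H : Graph) → ∀ a b → unionAdj G H a b ≡ unionAdj G H b a
unionSym G H a b with splitAt (n G) a | splitAt (n G) b
... | inj₁ u | inj₁ v = sym G u v
... | inj₂ u | inj₂ v = sym H u v
... | inj₁ _ | inj₂ _ = refl
... | inj₂ _ | inj₁ _ = refl

unionIrrefl : (G H : Graph) → ∀ a → unionAdj G H a a ≡ false
unionIrrefl G H a with splitAt (n G) a
... | inj₁ u = irrefl G u
... | inj₂ u = irrefl H u

_⊕_ : Graph → Graph → Graph
G ⊕ H = record { n = n G + n H ; adj = unionAdj G H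
               ; sym = unionSym G H ; irrefl = unionIrrefl G H }

allFin : ∀ {k} → (Fin k → Bool) → Bool
allFin {zero}  p = true
allFin {suc k} p = p Fin.zero ∧ allFin (λ i → p (Fin.suc i))
  where import Data.Fin as Fin

-- Color refinement: sameColor G i u v = true iff C_i(u) = C_i(v).
-- C_0 is uniform; C_{i+1}(u) = C_{i+1}(v) iff C_i(u) = C_i(v) and the
-- multisets {{C_i(w) : w ∈ N(u)}} and {{C_i(w) : w ∈ N(v)}} coincide, i.e.
-- every colour class of C_i (the class of some vertex z) contains equally
-- many neighbours of u and of v.
sameColor : (G : Graph) → ℕ → Fin (n G) → Fin (n G) → Bool
sameColor G zero    u v = true
sameColor G (suc i) u v =
  sameColor G i u v ∧
  allFin (λ z → ∣ nbhd G u ∩ tabulate (λ w → sameColor G i w z) ∣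
              ≡ᵇ ∣ nbhd G v ∩ tabulate (λ w → sameColor G i w z) ∣)

-- Stable colouring C: C(u) = C(v) iff C_i(u) = C_i(v) for every i
-- (the partitions only refine, and C is the partition at stabilisation).
SameStableColor : (G : Graph) → Fin (n G) → Fin (n G) → Set
SameStableColor G u v = ∀ i → sameColor G i u v ≡ true

-- Repeatedly deleting the vertices with at most one remaining neighbour deletes
-- exactly the vertices outside the core.  The set deleted after k rounds is a union
-- of classes of the stable colouring, because that colouring is equitable: two
-- vertices of the same colour have equally many neighbours in every union of colour
-- classes.  Hence the round in which a vertex is deleted (its rank) is a colour
-- invariant, and inside T_x the children of a vertex are exactly its neighbours of
-- smaller rank, the remaining neighbour being its parent.  For same-coloured u and
-- u' every colour class therefore contains equally many children of u and of u',
-- so their children can be matched colour by colour; matching downwards from two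
-- same-coloured roots x, y builds an isomorphism T_x ≅ T_y.  For two graphs G, H
-- the same argument runs in G ⊕ H, whose core is the union of the two cores, and
-- the isomorphism restricts to the two components.

module Submission where

open import Defs
open import Data.Fin using (Fin; _↑ˡ_; _↑ʳ_)
open import Data.Fin.Subset using (Subset; _∈_)
open import Data.Product using (_×_)
open import Relation.Nullary using (¬_)

open import Data.Bool using (Bool; true; false; _∧_; _∨_; not; if_then_else_)
open import Data.Bool.Properties
  using (∧-conicalˡ; ∧-conicalʳ; ∧-zeroʳ; ∧-identityʳ; ∧-assoc; not-injective; ¬-not; T-≡)
  renaming (_≟_ to _≟ᵇ_)
open import Data.Empty using (⊥; ⊥-elim)
open import Data.Fin using (zero; suc; splitAt; combine; remQuot)
open import Data.Fin.Properties
  using ( all?; any?; ¬∀⟶∃¬; remQuot-combine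
        ; splitAt-↑ˡ; splitAt-↑ʳ; splitAt⁻¹-↑ˡ; splitAt⁻¹-↑ʳ)
open import Data.Fin.Subset using (_∉_; _⊆_; _∩_; ∣_∣)
open import Data.Maybe using (Maybe; just; nothing; fromMaybe)
import Data.Maybe as Maybe
open import Data.Nat
  using (ℕ; zero; suc; _+_; _*_; _≤_; _<_; z≤n; s≤s; _≤ᵇ_; _<?_; _≤′_; ≤′-refl; ≤′-step)
open import Data.Nat.Properties
open import Algebra.Properties.CommutativeMonoid.Sum +-0-commutativeMonoid
  using (sum; sum-cong-≗; ∑-distrib-+; sum-replicate-zero)
open import Data.Product using (∃; _,_; proj₁; proj₂; uncurry; map₂)
open import Data.Sum using (_⊎_; inj₁; inj₂; [_,_]′)
open import Data.Vec using ([]; _∷_; lookup; tabulate; _++_)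
open import Data.Vec.Properties
  using ( lookup∘tabulate; lookup-zipWith; lookup-++ˡ; lookup-++ʳ; []=⇒lookup; lookup⇒[]=
        ; tabulate-cong; tabulate∘lookup)
open import Function using (_∘_; id; Equivalence)
open import Relation.Nullary using (yes; no)
open import Relation.Binary.Structures using (IsEquivalence)
open import Relation.Binary.PropositionalEquality as ≡
  using (_≡_; refl; trans; cong; cong₂; subst; subst₂)

true≢false : ∀ {b} → b ≡ true → b ≡ false → ⊥
true≢false refl ()

∧-intro : ∀ {a b} → a ≡ true → b ≡ true → a ∧ b ≡ true
∧-intro refl refl = refl

bool-ext : ∀ {a b} → (a ≡ true → b ≡ true) → (b ≡ true → a ≡ true) → a ≡ b
bool-ext {false} {false} _   _   = refl
bool-ext {false} {true}  _   b⇒a = b⇒a refl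
bool-ext {true}          a⇒b _   = ≡.sym (a⇒b refl)

sum-mono : ∀ {m} {f g : Fin m → ℕ} → (∀ i → f i ≤ g i) → sum f ≤ sum g
sum-mono {zero}  f≤g = z≤n
sum-mono {suc m} f≤g = +-mono-≤ (f≤g zero) (sum-mono (f≤g ∘ suc))

sum-strict : ∀ {m} {f g : Fin m → ℕ} → (∀ i → f i ≤ g i) → ∀ j → f j < g j → sum f < sum g
sum-strict f≤g zero    fj<gj = +-mono-<-≤ fj<gj (sum-mono (f≤g ∘ suc))
sum-strict f≤g (suc j) fj<gj = +-mono-≤-< (f≤g zero) (sum-strict (f≤g ∘ suc) j fj<gj)

sum-bounded : ∀ {m} c {f : Fin m → ℕ} → (∀ i → f i ≤ c) → sum f ≤ m * c
sum-bounded {zero}  c f≤c = z≤n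
sum-bounded {suc m} c f≤c = +-mono-≤ (f≤c zero) (sum-bounded c (f≤c ∘ suc))

sum-↑ : ∀ m k (f : Fin (m + k) → ℕ) → sum f ≡ sum (f ∘ (_↑ˡ k)) + sum (f ∘ (m ↑ʳ_))
sum-↑ zero    k f = refl
sum-↑ (suc m) k f = trans (cong (f zero +_) (sum-↑ m k (f ∘ suc))) (≡.sym (+-assoc (f zero) _ _))

indicator : Bool → ℕ
indicator true  = 1
indicator false = 0

count : ∀ {m} → (Fin m → Bool) → ℕ
count p = sum (indicator ∘ p)

count-↑ : ∀ m k (p : Fin (m + k) → Bool) → count p ≡ count (p ∘ (_↑ˡ k)) + count (p ∘ (m ↑ʳ_))
count-↑ m k p = sum-↑ m k (indicator ∘ p)

_⊆ᵇ_ : ∀ {m} → (Fin m → Bool) → (Fin m → Bool) → Set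
p ⊆ᵇ q = ∀ i → p i ≡ true → q i ≡ true

module _ {m : ℕ} where

  count-cong : {p q : Fin m → Bool} → (∀ i → p i ≡ q i) → count p ≡ count q
  count-cong p≗q = sum-cong-≗ (cong indicator ∘ p≗q)

  count-none : {p : Fin m → Bool} → (∀ i → p i ≡ false) → count p ≡ 0
  count-none p≗false = trans (count-cong p≗false) (sum-replicate-zero m)

  count≤ : (p : Fin m → Bool) → count p ≤ m
  count≤ p = subst (count p ≤_) (*-identityʳ m) (sum-bounded 1 (indicator≤1 ∘ p))
    where
    indicator≤1 : ∀ b → indicator b ≤ 1
    indicator≤1 true  = s≤s z≤n
    indicator≤1 false = z≤n

  private
    indicator-mono : ∀ a b → (a ≡ true → b ≡ true) → indicator a ≤ indicator b
    indicator-mono false b a⇒b = z≤n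
    indicator-mono true  b a⇒b rewrite a⇒b refl = s≤s z≤n

    indicator-< : ∀ {a b} → a ≡ false → b ≡ true → indicator a < indicator b
    indicator-< refl refl = s≤s z≤n

  count-mono : {p q : Fin m → Bool} → p ⊆ᵇ q → count p ≤ count q
  count-mono p⊆q = sum-mono (λ i → indicator-mono _ _ (p⊆q i))

  count-strict : {p q : Fin m → Bool} → p ⊆ᵇ q → ∀ j → p j ≡ false → q j ≡ true → count p < count q
  count-strict p⊆q j pj qj = sum-strict (λ i → indicator-mono _ _ (p⊆q i)) j (indicator-< pj qj)

  count-split : (p q : Fin m → Bool) →
                count p ≡ count (λ i → p i ∧ q i) + count (λ i → p i ∧ not (q i))
  count-split p q = trans (sum-cong-≗ (λ i → split (p i) (q i)))
                          (∑-distrib-+ (λ i → indicator (p i ∧ q i)) (λ i → indicator (p i ∧ not (q i))))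
    where
    split : ∀ a b → indicator a ≡ indicator (a ∧ b) + indicator (a ∧ not b)
    split false b     = refl
    split true  true  = refl
    split true  false = refl

count-positive : ∀ {m} (p : Fin m → Bool) i → p i ≡ true → 0 < count p
count-positive p zero    pi rewrite pi = s≤s z≤n
count-positive p (suc i) pi = <-≤-trans (count-positive (p ∘ suc) i pi) (m≤n+m _ _)

count≤1⇒unique : ∀ {m} (p : Fin m → Bool) → count p ≤ 1 →
                 ∀ a b → p a ≡ true → p b ≡ true → a ≡ b
count≤1⇒unique p p≤1 zero    zero    pa pb = refl
count≤1⇒unique p p≤1 zero    (suc b) pa pb rewrite pa =
  ⊥-elim (<-irrefl refl (≤-trans (s≤s (count-positive (p ∘ suc) b pb)) p≤1))
count≤1⇒unique p p≤1 (suc a) zero    pa pb = ≡.sym (count≤1⇒unique p p≤1 zero (suc a) pb pa)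
count≤1⇒unique p p≤1 (suc a) (suc b) pa pb =
  cong suc (count≤1⇒unique (p ∘ suc) (≤-trans (m≤n+m _ (indicator (p zero))) p≤1) a b pa pb)

position : ∀ {m} → (Fin m → Bool) → Fin m → ℕ
position p zero    = 0
position p (suc c) = indicator (p zero) + position (p ∘ suc) c

element : ∀ {m} → (Fin m → Bool) → ℕ → Maybe (Fin m)
element {zero}  p j = nothing
element {suc m} p j with p zero | j
... | false | j     = Maybe.map suc (element (p ∘ suc) j)
... | true  | zero  = just zero
... | true  | suc j = Maybe.map suc (element (p ∘ suc) j)

position<count : ∀ {m} (p : Fin m → Bool) c → p c ≡ true → position p c < count p
position<count p zero    pc rewrite pc = s≤s z≤n
position<count p (suc c) pc = +-monoʳ-< (indicator (p zero)) (position<count (p ∘ suc) c pc)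

element-position : ∀ {m} (p : Fin m → Bool) c → p c ≡ true → element p (position p c) ≡ just c
element-position p zero    pc rewrite pc = refl
element-position p (suc c) pc with p zero
... | false rewrite element-position (p ∘ suc) c pc = refl
... | true  rewrite element-position (p ∘ suc) c pc = refl

position-suc : ∀ {m b} (p : Fin (suc m) → Bool) c → p zero ≡ b →
               position p (suc c) ≡ indicator b + position (p ∘ suc) c
position-suc p c = cong (λ b → indicator b + position (p ∘ suc) c)

element-exists : ∀ {m} (p : Fin m → Bool) j → j < count p →
                 ∃ λ c → element p j ≡ just c × p c ≡ true × position p c ≡ j
element-exists {suc m} p j j<count with p zero in p0
element-exists {suc m} p j j<count | false with element-exists (p ∘ suc) j j<count
... | c , el , pc , pos rewrite el = suc c , refl , pc , trans (position-suc p c p0) pos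
element-exists {suc m} p zero    j<count | true = zero , refl , p0 , refl
element-exists {suc m} p (suc j) (s≤s j<count) | true with element-exists (p ∘ suc) j j<count
... | c , el , pc , pos rewrite el = suc c , refl , pc , trans (position-suc p c p0) (cong suc pos)

position-cong : ∀ {m} {p q : Fin m → Bool} → (∀ i → p i ≡ q i) → ∀ c → position p c ≡ position q c
position-cong p≗q zero    = refl
position-cong p≗q (suc c) = cong₂ _+_ (cong indicator (p≗q zero)) (position-cong (p≗q ∘ suc) c)

element-cong : ∀ {m} {p q : Fin m → Bool} → (∀ i → p i ≡ q i) → ∀ j → element p j ≡ element q j
element-cong {zero}          p≗q j = refl
element-cong {suc m} {p} {q} p≗q j with p zero | q zero | p≗q zero
... | false | .false | refl = cong (Maybe.map suc) (element-cong (p≗q ∘ suc) j)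
... | true  | .true  | refl with j
...   | zero  = refl
...   | suc j = cong (Maybe.map suc) (element-cong (p≗q ∘ suc) j)

match : ∀ {m} → (Fin m → Bool) → (Fin m → Bool) → Fin m → Fin m
match p q c = fromMaybe c (element q (position p c))

match-cong : ∀ {m} {p p′ q q′ : Fin m → Bool} → (∀ i → p i ≡ p′ i) → (∀ i → q i ≡ q′ i) →
             ∀ c → match p q c ≡ match p′ q′ c
match-cong p≗p′ q≗q′ c =
  cong (fromMaybe c) (trans (cong (element _) (position-cong p≗p′ c)) (element-cong q≗q′ _))

match-correct : ∀ {m} (p q : Fin m → Bool) → count p ≡ count q → ∀ c → p c ≡ true →
                q (match p q c) ≡ true × match q p (match p q c) ≡ c
match-correct p q p≈q c pc
  with element-exists q (position p c) (subst (position p c <_) p≈q (position<count p c pc))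
... | c′ , el , qc′ , pos rewrite el | pos | element-position p c pc = qc′ , refl

stabilises : (μ : ℕ → ℕ) (B : ℕ) (P : ℕ → Set) →
             (∀ k → μ k ≤ B) → (∀ k → P k ⊎ μ k < μ (suc k)) → ∃ P
stabilises μ B P μ≤B progress =
  [ id , (λ B<μ → ⊥-elim (<⇒≱ B<μ (μ≤B (suc B)))) ]′ (grows (suc B))
  where
  grows : ∀ k → ∃ P ⊎ k ≤ μ k
  grows zero = inj₂ z≤n
  grows (suc k) with grows k
  ... | inj₁ p = inj₁ p
  ... | inj₂ k≤μk with progress k
  ...   | inj₁ pk      = inj₁ (k , pk)
  ...   | inj₂ μk<μk+1 = inj₂ (≤-<-trans k≤μk μk<μk+1)

increasing-stabilises : ∀ {m} (P : ℕ → Fin m → Bool) → (∀ k → P k ⊆ᵇ P (suc k)) →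
                        ∃ λ k → ∀ i → P (suc k) i ≡ P k i
increasing-stabilises {m} P P⊆P′ = stabilises (count ∘ P) m _ (count≤ ∘ P) progress
  where
  strictly : ∀ a b → (a ≡ true → b ≡ true) → ¬ b ≡ a → a ≡ false × b ≡ true
  strictly false true  _   _   = refl , refl
  strictly false false _   b≢a = ⊥-elim (b≢a refl)
  strictly true  true  _   b≢a = ⊥-elim (b≢a refl)
  strictly true  false a⇒b _   = ⊥-elim (true≢false (a⇒b refl) refl)
  progress : ∀ k → (∀ i → P (suc k) i ≡ P k i) ⊎ count (P k) < count (P (suc k))
  progress k with all? (λ i → P (suc k) i ≟ᵇ P k i)
  ... | yes stable = inj₁ stable
  ... | no unstable with ¬∀⟶∃¬ m _ (λ i → P (suc k) i ≟ᵇ P k i) unstable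
  ...   | i , Pi≢ with strictly (P k i) (P (suc k) i) (P⊆P′ k i) Pi≢
  ...     | Pki , Pk′i = inj₂ (count-strict (P⊆P′ k) i Pki Pk′i)

least : (ℕ → Bool) → ℕ → ℕ
least p zero    = zero
least p (suc m) with p zero
... | true  = zero
... | false = suc (least (p ∘ suc) m)

least≤ : ∀ (p : ℕ → Bool) m → least p m ≤ m
least≤ p zero    = z≤n
least≤ p (suc m) with p zero
... | true  = z≤n
... | false = s≤s (least≤ (p ∘ suc) m)

least-minimal : ∀ (p : ℕ → Bool) m j → j < least p m → p j ≡ false
least-minimal p (suc m) j j<least with p zero in p0
least-minimal p (suc m) zero    j<least       | false = p0
least-minimal p (suc m) (suc j) (s≤s j<least) | false = least-minimal (p ∘ suc) m j j<least

least-satisfies : ∀ (p : ℕ → Bool) m → least p m < m → p (least p m) ≡ true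
least-satisfies p (suc m) least<m with p zero in p0
least-satisfies p (suc m) least<m       | true  = p0
least-satisfies p (suc m) (s≤s least<m) | false = least-satisfies (p ∘ suc) m least<m

least-none : ∀ (p : ℕ → Bool) m → (∀ j → p j ≡ false) → least p m ≡ m
least-none p zero    none = refl
least-none p (suc m) none rewrite none zero = cong suc (least-none (p ∘ suc) m (none ∘ suc))

least-cong : ∀ {p q : ℕ → Bool} m → (∀ j → p j ≡ q j) → least p m ≡ least q m
least-cong zero    p≗q = refl
least-cong {p} {q} (suc m) p≗q with p zero | q zero | p≗q zero
... | true  | .true  | refl = refl
... | false | .false | refl = cong suc (least-cong m (p≗q ∘ suc))

∈-tabulate⁺ : ∀ {m} {f : Fin m → Bool} {i} → f i ≡ true → i ∈ tabulate f
∈-tabulate⁺ {f = f} {i} fi = lookup⇒[]= i _ (trans (lookup∘tabulate f i) fi)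

∈-tabulate⁻ : ∀ {m} {f : Fin m → Bool} {i} → i ∈ tabulate f → f i ≡ true
∈-tabulate⁻ {f = f} {i} i∈ = trans (≡.sym (lookup∘tabulate f i)) ([]=⇒lookup i∈)

∉⇒lookup≡false : ∀ {m} {S : Subset m} {i} → i ∉ S → lookup S i ≡ false
∉⇒lookup≡false {S = S} {i} i∉S with lookup S i in Si
... | true  = ⊥-elim (i∉S (lookup⇒[]= i S Si))
... | false = refl

∣∣≡count : ∀ {m} (S : Subset m) → ∣ S ∣ ≡ count (lookup S)
∣∣≡count []          = refl
∣∣≡count (true ∷ S)  = cong suc (∣∣≡count S)
∣∣≡count (false ∷ S) = ∣∣≡count S

∣tabulate∩∣ : ∀ {m} (f : Fin m → Bool) (S : Subset m) → ∣ tabulate f ∩ S ∣ ≡ count (λ w → f w ∧ lookup S w)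
∣tabulate∩∣ f S = trans (∣∣≡count (tabulate f ∩ S)) (count-cong λ i →
  trans (lookup-zipWith _∧_ i (tabulate f) S) (cong (_∧ lookup S i) (lookup∘tabulate f i)))

∣tabulate∩tabulate∣ : ∀ {m} (f g : Fin m → Bool) → ∣ tabulate f ∩ tabulate g ∣ ≡ count (λ w → f w ∧ g w)
∣tabulate∩tabulate∣ f g =
  trans (∣tabulate∩∣ f (tabulate g)) (count-cong λ w → cong (f w ∧_) (lookup∘tabulate g w))

allFin⁻ : ∀ {m} {p : Fin m → Bool} → allFin p ≡ true → ∀ z → p z ≡ true
allFin⁻ {suc m} {p} all zero    = ∧-conicalˡ (p zero) _ all
allFin⁻ {suc m} {p} all (suc z) = allFin⁻ (∧-conicalʳ (p zero) _ all) z

allFin⁺ : ∀ {m} {p : Fin m → Bool} → (∀ z → p z ≡ true) → allFin p ≡ true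
allFin⁺ {zero}  all = refl
allFin⁺ {suc m} all = ∧-intro (all zero) (allFin⁺ (all ∘ suc))

module ColourRefinement (F : Graph) where

  private
    V = Fin (n F)

  classCount : ℕ → V → V → ℕ
  classCount i u z = count (λ w → adj F u w ∧ sameColor F i w z)

  private
    ∣nbhd∩class∣ : ∀ i u z → ∣ nbhd F u ∩ tabulate (λ w → sameColor F i w z) ∣ ≡ classCount i u z
    ∣nbhd∩class∣ i u z = ∣tabulate∩tabulate∣ (adj F u) (λ w → sameColor F i w z)

  sameColor-suc⁻ : ∀ i u v → sameColor F (suc i) u v ≡ true →
                   sameColor F i u v ≡ true × (∀ z → classCount i u z ≡ classCount i v z)
  sameColor-suc⁻ i u v same = ∧-conicalˡ _ _ same , λ z →
    trans (≡.sym (∣nbhd∩class∣ i u z))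
      (trans (≡ᵇ⇒≡ _ _ (Equivalence.from T-≡ (allFin⁻ (∧-conicalʳ _ _ same) z))) (∣nbhd∩class∣ i v z))

  sameColor-suc⁺ : ∀ i u v → sameColor F i u v ≡ true → (∀ z → classCount i u z ≡ classCount i v z) →
                   sameColor F (suc i) u v ≡ true
  sameColor-suc⁺ i u v same counts = ∧-intro same (allFin⁺ λ z → Equivalence.to T-≡ (≡⇒≡ᵇ _ _
    (trans (∣nbhd∩class∣ i u z) (trans (counts z) (≡.sym (∣nbhd∩class∣ i v z))))))

  sameColor-isEquivalence : ∀ i → IsEquivalence (λ u v → sameColor F i u v ≡ true)
  sameColor-isEquivalence i =
    record { refl = reflexive i _ ; sym = symmetric i _ _ ; trans = transitive i _ _ _ }
    where
    reflexive : ∀ i u → sameColor F i u u ≡ true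
    reflexive zero    u = refl
    reflexive (suc i) u = sameColor-suc⁺ i u u (reflexive i u) (λ _ → refl)
    symmetric : ∀ i u v → sameColor F i u v ≡ true → sameColor F i v u ≡ true
    symmetric zero    u v _    = refl
    symmetric (suc i) u v same with sameColor-suc⁻ i u v same
    ... | same′ , counts = sameColor-suc⁺ i v u (symmetric i u v same′) (≡.sym ∘ counts)
    transitive : ∀ i u v w → sameColor F i u v ≡ true → sameColor F i v w ≡ true →
                 sameColor F i u w ≡ true
    transitive zero    u v w _     _     = refl
    transitive (suc i) u v w uv vw with sameColor-suc⁻ i u v uv | sameColor-suc⁻ i v w vw
    ... | uv′ , uv-counts | vw′ , vw-counts =
      sameColor-suc⁺ i u w (transitive i u v w uv′ vw′) (λ z → trans (uv-counts z) (vw-counts z))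

  sameColor-stabilises : ∃ λ M → ∀ u v → sameColor F (suc M) u v ≡ sameColor F M u v
  sameColor-stabilises =
    map₂ (λ {M} → unpair {M}) (increasing-stabilises distinct (λ i k → refines i (remQuot (n F) k)))
    where
    distinct : ℕ → Fin (n F * n F) → Bool
    distinct i k = not (uncurry (sameColor F i) (remQuot (n F) k))
    refines : ∀ i (uv : V × V) → not (uncurry (sameColor F i) uv) ≡ true →
              not (uncurry (sameColor F (suc i)) uv) ≡ true
    refines i (u , v) different with sameColor F (suc i) u v in same
    ... | false = refl
    ... | true  = ⊥-elim (true≢false (proj₁ (sameColor-suc⁻ i u v same)) (not-injective different))
    distinct-combine : ∀ i u v → distinct i (combine u v) ≡ not (sameColor F i u v)
    distinct-combine i u v = cong (not ∘ uncurry (sameColor F i)) (remQuot-combine u v)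
    unpair : ∀ {M} → (∀ k → distinct (suc M) k ≡ distinct M k) →
             ∀ u v → sameColor F (suc M) u v ≡ sameColor F M u v
    unpair {M} stable u v = not-injective (begin
      not (sameColor F (suc M) u v)  ≡⟨ ≡.sym (distinct-combine (suc M) u v) ⟩
      distinct (suc M) (combine u v) ≡⟨ stable (combine u v) ⟩
      distinct M (combine u v)       ≡⟨ distinct-combine M u v ⟩
      not (sameColor F M u v)        ∎)
      where open ≡.≡-Reasoning

Closed : ∀ {m} → (Fin m → Fin m → Bool) → (Fin m → Bool) → Set
Closed E S = ∀ u v → E u v ≡ true → S u ≡ S v

module _ {m} {E : Fin m → Fin m → Bool} (E-equiv : IsEquivalence (λ u v → E u v ≡ true)) where

  private
    module E = IsEquivalence E-equiv

  count-closed : ∀ (a b : Fin m → Bool) → (∀ z → count (λ w → a w ∧ E w z) ≡ count (λ w → b w ∧ E w z)) →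
                 ∀ S → Closed E S → count (λ w → a w ∧ S w) ≡ count (λ w → b w ∧ S w)
  count-closed a b per-class S₀ closed₀ = go (count S₀) S₀ closed₀ ≤-refl
    where
    go : ∀ k S → Closed E S → count S ≤ k → count (λ w → a w ∧ S w) ≡ count (λ w → b w ∧ S w)
    go k S closed S≤k with any? (λ z → S z ≟ᵇ true)
    ... | no empty = trans (count-none (vanish a)) (≡.sym (count-none (vanish b)))
      where
      vanish : ∀ c w → c w ∧ S w ≡ false
      vanish c w = trans (cong (c w ∧_) (¬-not (λ Sw → empty (w , Sw)))) (∧-zeroʳ (c w))
    go zero    S closed S≤k | yes (z , Sz) = ⊥-elim (<-irrefl refl (<-≤-trans (count-positive S z Sz) S≤k))
    go (suc k) S closed S≤k | yes (z , Sz) = begin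
      count (λ w → a w ∧ S w)
        ≡⟨ count-split _ (λ w → E w z) ⟩
      count (λ w → (a w ∧ S w) ∧ E w z) + count (λ w → (a w ∧ S w) ∧ not (E w z))
        ≡⟨ cong₂ _+_ (trans (count-cong (in-class a)) (trans (per-class z) (≡.sym (count-cong (in-class b)))))
                     (trans (count-cong (λ w → ∧-assoc (a w) _ _))
                       (trans (go k S′ closed′ S′≤k) (≡.sym (count-cong (λ w → ∧-assoc (b w) _ _))))) ⟩
      count (λ w → (b w ∧ S w) ∧ E w z) + count (λ w → (b w ∧ S w) ∧ not (E w z))
        ≡⟨ ≡.sym (count-split _ (λ w → E w z)) ⟩
      count (λ w → b w ∧ S w)
        ∎
      where
      open ≡.≡-Reasoning
      in-class : ∀ (c : Fin m → Bool) w → (c w ∧ S w) ∧ E w z ≡ c w ∧ E w z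
      in-class c w with E w z in wz
      ... | false = trans (∧-zeroʳ _) (≡.sym (∧-zeroʳ _))
      ... | true  = trans (cong (λ s → (c w ∧ s) ∧ true) (trans (closed w z wz) Sz))
                          (∧-identityʳ (c w ∧ true))
      S′ : Fin m → Bool
      S′ w = S w ∧ not (E w z)
      closed′ : Closed E S′
      closed′ u v uv = cong₂ _∧_ (closed u v uv) (cong not (same-class uv))
        where
        same-class : ∀ {u v} → E u v ≡ true → E u z ≡ E v z
        same-class {u} {v} uv with E u z in uz | E v z in vz
        ... | true  | true  = refl
        ... | false | false = refl
        ... | true  | false = ⊥-elim (true≢false (E.trans (E.sym uv) uz) vz)
        ... | false | true  = ⊥-elim (true≢false (E.trans uv vz) uz)
      S′≤k : count S′ ≤ k
      S′≤k = ≤-pred (≤-trans (count-strict (λ w → ∧-conicalˡ (S w) _) z S′z Sz) S≤k)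
        where
        S′z : S′ z ≡ false
        S′z rewrite E.refl {z} = ∧-zeroʳ (S z)

peeled : (F : Graph) → ℕ → Fin (n F) → Bool
peeled F zero    w = false
peeled F (suc k) w = peeled F k w ∨ (count (λ u → adj F w u ∧ not (peeled F k u)) ≤ᵇ 1)

≤ᵇ1⇒≤1 : ∀ c → (c ≤ᵇ 1) ≡ true → c ≤ 1
≤ᵇ1⇒≤1 zero          _ = z≤n
≤ᵇ1⇒≤1 (suc zero)    _ = s≤s z≤n

≰ᵇ1⇒2≤ : ∀ c → (c ≤ᵇ 1) ≡ false → 2 ≤ c
≰ᵇ1⇒2≤ (suc (suc c)) _ = s≤s (s≤s z≤n)

2≤⇒≰ᵇ1 : ∀ {c} → 2 ≤ c → (c ≤ᵇ 1) ≡ false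
2≤⇒≰ᵇ1 (s≤s (s≤s _)) = refl

module Peeling (F : Graph) where

  peeled-suc : ∀ k → peeled F k ⊆ᵇ peeled F (suc k)
  peeled-suc k w peeledw rewrite peeledw = refl

  peeled-mono : ∀ {k l} w → k ≤ l → peeled F k w ≡ true → peeled F l w ≡ true
  peeled-mono {k} {l} w k≤l = go (≤⇒≤′ k≤l)
    where
    go : ∀ {l} → k ≤′ l → peeled F k w ≡ true → peeled F l w ≡ true
    go ≤′-refl                = id
    go {suc l} (≤′-step k≤′l) = peeled-suc l w ∘ go k≤′l

  peeling-stabilises : ∃ λ N → ∀ w → peeled F (suc N) w ≡ peeled F N w
  peeling-stabilises = increasing-stabilises (peeled F) peeled-suc

  module _ {K : Subset (n F)} (isCore : IsCore F K) where

    core-unpeeled : ∀ k {w} → w ∈ K → peeled F k w ≡ false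
    core-unpeeled zero    w∈K = refl
    core-unpeeled (suc k) {w} w∈K rewrite core-unpeeled k w∈K = 2≤⇒≰ᵇ1 (begin
      2                                          ≤⟨ proj₁ isCore w w∈K ⟩
      ∣ nbhd F w ∩ K ∣                            ≡⟨ ∣tabulate∩∣ (adj F w) K ⟩
      count (λ u → adj F w u ∧ lookup K u)       ≤⟨ count-mono core-neighbour ⟩
      count (λ u → adj F w u ∧ not (peeled F k u)) ∎)
      where
      open ≤-Reasoning
      core-neighbour : (λ u → adj F w u ∧ lookup K u) ⊆ᵇ (λ u → adj F w u ∧ not (peeled F k u))
      core-neighbour u wu∈K = ∧-intro (∧-conicalˡ _ _ wu∈K)
        (cong not (core-unpeeled k (lookup⇒[]= u K (∧-conicalʳ (adj F w u) _ wu∈K))))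

    noncore-peeled : ∀ N → (∀ w → peeled F (suc N) w ≡ peeled F N w) →
                     ∀ {w} → w ∉ K → peeled F N w ≡ true
    noncore-peeled N stable {w} w∉K with peeled F N w in peeledw
    ... | true  = refl
    ... | false = ⊥-elim (w∉K (proj₂ isCore unpeeled unpeeled-minDeg2 (∈-tabulate⁺ (cong not peeledw))))
      where
      unpeeled : Subset (n F)
      unpeeled = tabulate (not ∘ peeled F N)
      unpeeled-minDeg2 : MinDeg2 F unpeeled
      unpeeled-minDeg2 v v∈ = begin
        2                                             ≤⟨ ≰ᵇ1⇒2≤ _ (∨-falseʳ (trans (stable v) peeledv)) ⟩
        count (λ u → adj F v u ∧ not (peeled F N u))  ≡⟨ ≡.sym (∣tabulate∩tabulate∣ (adj F v) _) ⟩
        ∣ nbhd F v ∩ unpeeled ∣                        ∎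
        where
        open ≤-Reasoning
        peeledv : peeled F N v ≡ false
        peeledv = not-injective (∈-tabulate⁻ v∈)
        ∨-falseʳ : ∀ {a b} → a ∨ b ≡ false → b ≡ false
        ∨-falseʳ {false} e = e

module StableColourTrees
  (F : Graph) {K : Subset (n F)} (isCore : IsCore F K)
  (N : ℕ) (N-stable : ∀ w → peeled F (suc N) w ≡ peeled F N w)
  (M : ℕ) (M-stable : ∀ u v → sameColor F (suc M) u v ≡ sameColor F M u v)
  where

  open Peeling F
  open ColourRefinement F

  private
    V = Fin (n F)
    A = adj F

  E : V → V → Bool
  E = sameColor F M

  private
    module E = IsEquivalence (sameColor-isEquivalence M)

  E-equitable : ∀ {u v} → E u v ≡ true → ∀ z → classCount M u z ≡ classCount M v z
  E-equitable {u} {v} uv = proj₂ (sameColor-suc⁻ M u v (trans (M-stable u v) uv))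

  E-neighbours : ∀ {u v} → E u v ≡ true → ∀ S → Closed E S →
                 count (λ w → A u w ∧ S w) ≡ count (λ w → A v w ∧ S w)
  E-neighbours {u} {v} uv = count-closed (sameColor-isEquivalence M) (A u) (A v) (E-equitable uv)

  peeled-closed : ∀ k → Closed E (peeled F k)
  peeled-closed zero    u v uv = refl
  peeled-closed (suc k) u v uv = cong₂ _∨_ (peeled-closed k u v uv)
    (cong (_≤ᵇ 1) (E-neighbours uv (not ∘ peeled F k) (λ u′ v′ → cong not ∘ peeled-closed k u′ v′)))

  rank : V → ℕ
  rank w = least (λ k → peeled F (suc k) w) N

  rank≤N : ∀ w → rank w ≤ N
  rank≤N w = least≤ _ N

  rank-unpeeled : ∀ w → peeled F (rank w) w ≡ false
  rank-unpeeled w with rank w in rankw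
  ... | zero  = refl
  ... | suc j = least-minimal _ N j (≤-reflexive (≡.sym rankw))

  rank-core : ∀ {w} → w ∈ K → rank w ≡ N
  rank-core w∈K = least-none _ N (λ j → core-unpeeled isCore (suc j) w∈K)

  peeled⇒rank< : ∀ {k w} → peeled F k w ≡ true → rank w < k
  peeled⇒rank< {k} {w} peeledw with rank w <? k
  ... | yes rank<k = rank<k
  ... | no  rank≮k = ⊥-elim (true≢false (peeled-mono w (≮⇒≥ rank≮k) peeledw) (rank-unpeeled w))

  rank-peeled : ∀ {w} → w ∉ K → peeled F (suc (rank w)) w ≡ true
  rank-peeled w∉K = least-satisfies _ N (peeled⇒rank< (noncore-peeled isCore N N-stable w∉K))

  rank-closed : ∀ {u v} → E u v ≡ true → rank u ≡ rank v
  rank-closed uv = least-cong N (λ j → peeled-closed (suc j) _ _ uv)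

  child : V → V → Bool
  child u c = A u c ∧ peeled F (rank u) c

  child-rank : ∀ {u c} → child u c ≡ true → rank c < rank u
  child-rank {u} {c} uc = peeled⇒rank< (∧-conicalʳ (A u c) _ uc)

  child-noncore : ∀ {u c} → child u c ≡ true → c ∉ K
  child-noncore {u} {c} uc c∈K =
    true≢false (∧-conicalʳ (A u c) _ uc) (core-unpeeled isCore (rank u) c∈K)

  root-child : ∀ {r c} → r ∈ K → A r c ≡ true → c ∉ K → child r c ≡ true
  root-child r∈K rc c∉K = ∧-intro rc
    (subst (λ k → peeled F k _ ≡ true) (≡.sym (rank-core r∈K)) (noncore-peeled isCore N N-stable c∉K))

  upward : V → V → Bool
  upward w p = A w p ∧ not (peeled F (rank w) p)

  upward-unique : ∀ {w} → w ∉ K → ∀ {a b} → upward w a ≡ true → upward w b ≡ true → a ≡ b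
  upward-unique {w} w∉K = count≤1⇒unique (upward w)
    (≤ᵇ1⇒≤1 _ (second-disjunct (rank-unpeeled w) (rank-peeled w∉K))) _ _
    where
    second-disjunct : ∀ {a b} → a ≡ false → a ∨ b ≡ true → b ≡ true
    second-disjunct refl b = b

  parent : V → V
  parent w = fromMaybe w (element (upward w) 0)

  parent-upward : ∀ {w a} → upward w a ≡ true → upward w (parent w) ≡ true
  parent-upward {w} {a} wa with element-exists (upward w) 0 (count-positive (upward w) a wa)
  ... | p , el , wp , _ rewrite el = wp

  parent-child : ∀ {u c} → child u c ≡ true → parent c ≡ u
  parent-child {u} {c} uc = upward-unique (child-noncore uc) (parent-upward cu) cu
    where
    u-unpeeled : peeled F (rank c) u ≡ false
    u-unpeeled with peeled F (rank c) u in peeledu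
    ... | false = refl
    ... | true  = ⊥-elim (<-asym (child-rank uc) (peeled⇒rank< peeledu))
    cu : upward c u ≡ true
    cu = ∧-intro (trans (Graph.sym F c u) (∧-conicalˡ _ _ uc)) (cong not u-unpeeled)

  noncore-neighbour : ∀ {w z} → w ∉ K → A w z ≡ true → z ≡ parent w ⊎ child w z ≡ true
  noncore-neighbour {w} {z} w∉K wz with peeled F (rank w) z in peeledz
  ... | true  = inj₂ (∧-intro wz refl)
  ... | false = inj₁ (upward-unique w∉K wz′ (parent-upward wz′))
    where
    wz′ : upward w z ≡ true
    wz′ = ∧-intro wz (cong not peeledz)

  data Descendant (r : V) : V → Set where
    here  : Descendant r r
    there : ∀ {u c} → Descendant r u → child u c ≡ true → Descendant r c

  Descendant⇒InTree : ∀ {r w} → Descendant r w → InTree F K r w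
  Descendant⇒InTree here         = root
  Descendant⇒InTree (there d uc) = step (Descendant⇒InTree d) (∧-conicalˡ _ _ uc) (child-noncore uc)

  child-or-parent : ∀ {r u v} → r ∈ K → Descendant r u → A u v ≡ true → v ∉ K →
                    child u v ≡ true ⊎ (∃ λ p → Descendant r p × child p u ≡ true × v ≡ p)
  child-or-parent r∈K here            rv v∉K = inj₁ (root-child r∈K rv v∉K)
  child-or-parent r∈K (there {p} d pu) uv v∉K with noncore-neighbour (child-noncore pu) uv
  ... | inj₁ v≡parent = inj₂ (p , d , pu , trans v≡parent (parent-child pu))
  ... | inj₂ uv′      = inj₁ uv′

  InTree⇒Descendant : ∀ {r w} → r ∈ K → InTree F K r w → Descendant r w
  InTree⇒Descendant r∈K root = here
  InTree⇒Descendant r∈K (step t uw w∉K) with child-or-parent r∈K (InTree⇒Descendant r∈K t) uw w∉K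
  ... | inj₁ uw′                 = there (InTree⇒Descendant r∈K t) uw′
  ... | inj₂ (p , d , _ , refl)  = d

  descendants-adjacent : ∀ {r u v} → r ∈ K → Descendant r u → Descendant r v → A u v ≡ true →
                         child u v ≡ true ⊎ child v u ≡ true
  descendants-adjacent {r} r∈K here here         rr = ⊥-elim (true≢false rr (Graph.irrefl F r))
  descendants-adjacent     r∈K here (there _ qv) rv = inj₁ (root-child r∈K rv (child-noncore qv))
  descendants-adjacent     r∈K (there d pu) _    uv with noncore-neighbour (child-noncore pu) uv
  ... | inj₁ v≡parent =
    inj₂ (subst (λ p → child p _ ≡ true) (≡.sym (trans v≡parent (parent-child pu))) pu)
  ... | inj₂ uv′      = inj₁ uv′

  childOfClass : V → V → V → Bool
  childOfClass u c w = child u w ∧ E w c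

  matchChild : V → V → V → V
  matchChild u u′ c = match (childOfClass u c) (childOfClass u′ c) c

  private
    childOfClass-adjacent : ∀ {u c} → peeled F (rank u) c ≡ true →
                            ∀ w → childOfClass u c w ≡ A u w ∧ E w c
    childOfClass-adjacent {u} {c} peeledc w with E w c in wc
    ... | false = trans (∧-zeroʳ _) (≡.sym (∧-zeroʳ _))
    ... | true  = trans (cong (λ b → (A u w ∧ b) ∧ true) (trans (peeled-closed (rank u) w c wc) peeledc))
                        (∧-identityʳ (A u w ∧ true))

  matchChild-correct : ∀ {u u′ c} → E u u′ ≡ true → child u c ≡ true →
                       child u′ (matchChild u u′ c) ≡ true × E c (matchChild u u′ c) ≡ true ×
                       matchChild u′ u (matchChild u u′ c) ≡ c
  matchChild-correct {u} {u′} {c} uu′ uc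
    with match-correct (childOfClass u c) (childOfClass u′ c) equinumerous c (∧-intro uc E.refl)
    where
    peeledc : peeled F (rank u) c ≡ true
    peeledc = ∧-conicalʳ (A u c) _ uc
    equinumerous : count (childOfClass u c) ≡ count (childOfClass u′ c)
    equinumerous = begin
      count (childOfClass u c)   ≡⟨ count-cong (childOfClass-adjacent peeledc) ⟩
      classCount M u c           ≡⟨ E-equitable uu′ c ⟩
      classCount M u′ c          ≡⟨ ≡.sym (count-cong (childOfClass-adjacent peeledc′)) ⟩
      count (childOfClass u′ c)  ∎
      where
      open ≡.≡-Reasoning
      peeledc′ : peeled F (rank u′) c ≡ true
      peeledc′ = subst (λ k → peeled F k c ≡ true) (rank-closed uu′) peeledc
  ... | u′c′ , back = ∧-conicalˡ _ _ u′c′ , E.sym c′c ,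
        trans (match-cong (cong (child u′ _ ∧_) ∘ same-class) (cong (child u _ ∧_) ∘ same-class) _) back
    where
    c′c : E (matchChild u u′ c) c ≡ true
    c′c = ∧-conicalʳ (child u′ _) _ u′c′
    same-class : ∀ w → E w (matchChild u u′ c) ≡ E w c
    same-class w = bool-ext (λ wc′ → E.trans wc′ c′c) (λ wc → E.trans wc (E.sym c′c))

  Fueled : V → ℕ → Set
  Fueled w f = N < rank w + f

  unfueled : ∀ {w} → ¬ Fueled w 0
  unfueled {w} N<rank = <⇒≱ (subst (N <_) (+-identityʳ (rank w)) N<rank) (rank≤N w)

  fueled : ∀ w → Fueled w (suc N)
  fueled w = m≤n+m (suc N) (rank w)

  fueled-parent : ∀ {u c f} → child u c ≡ true → Fueled c (suc f) → Fueled u f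
  fueled-parent {u} {c} {f} uc N<c+f+1 =
    ≤-trans N<c+f+1 (≤-trans (≤-reflexive (+-suc (rank c) f)) (+-monoˡ-≤ f (child-rank uc)))

  -- The image of w in T_b, by recursion along the path to the root: each child is
  -- matched with a child of the image of its parent.  Fuel f suffices once
  -- Fueled w f, since ranks strictly increase towards the root.
  transport : V → ℕ → V → V
  transport b zero    w = b
  transport b (suc f) w = if lookup K w then b else matchChild (parent w) (transport b f (parent w)) w

  transport-core : ∀ b f {w} → w ∈ K → transport b (suc f) w ≡ b
  transport-core b f w∈K rewrite []=⇒lookup w∈K = refl

  transport-child : ∀ b f {u c} → child u c ≡ true →
                    transport b (suc f) c ≡ matchChild u (transport b f u) c
  transport-child b f uc rewrite ∉⇒lookup≡false (child-noncore uc) | parent-child uc = refl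

  module Transport {a b : V} (a∈K : a ∈ K) (b∈K : b ∈ K) (ab : E a b ≡ true) where

    transport-correct : ∀ {w f} → Descendant a w → Fueled w f →
                        Descendant b (transport b f w) × E w (transport b f w) ≡ true
    transport-correct {f = zero}  d            fuel = ⊥-elim (unfueled fuel)
    transport-correct {f = suc f} here         fuel rewrite transport-core b f a∈K = here , ab
    transport-correct {f = suc f} (there d uc) fuel rewrite transport-child b f uc
      with transport-correct d (fueled-parent uc fuel)
    ... | du′ , uu′ with matchChild-correct uu′ uc
    ...   | u′c′ , cc′ , _ = there du′ u′c′ , cc′

    transport-refuel : ∀ {w f} → Descendant a w → Fueled w f → transport b (suc f) w ≡ transport b f w
    transport-refuel {f = zero}  d            fuel = ⊥-elim (unfueled fuel)
    transport-refuel {f = suc f} here         fuel =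
      trans (transport-core b (suc f) a∈K) (≡.sym (transport-core b f a∈K))
    transport-refuel {f = suc f} (there {u} {c} d uc) fuel = begin
      transport b (suc (suc f)) c             ≡⟨ transport-child b (suc f) uc ⟩
      matchChild u (transport b (suc f) u) c  ≡⟨ cong (λ u′ → matchChild u u′ c) (transport-refuel d fuel′) ⟩
      matchChild u (transport b f u) c        ≡⟨ ≡.sym (transport-child b f uc) ⟩
      transport b (suc f) c                   ∎
      where
      open ≡.≡-Reasoning
      fuel′ = fueled-parent uc fuel

    transport-inverse : ∀ {w f} → Descendant a w → Fueled w f → transport a f (transport b f w) ≡ w
    transport-inverse {f = zero}  d            fuel = ⊥-elim (unfueled fuel)
    transport-inverse {f = suc f} here         fuel rewrite transport-core b f a∈K = transport-core a f b∈K
    transport-inverse {f = suc f} (there {u} {c} d uc) fuel rewrite transport-child b f uc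
      with transport-correct d (fueled-parent uc fuel)
    ... | _ , uu′ with matchChild-correct uu′ uc
    ...   | u′c′ , _ , back = begin
      transport a (suc f) c′               ≡⟨ transport-child a f u′c′ ⟩
      matchChild u′ (transport a f u′) c′  ≡⟨ cong (λ u″ → matchChild u′ u″ c′) (transport-inverse d fuel′) ⟩
      matchChild u′ u c′                   ≡⟨ back ⟩
      c                                    ∎
      where
      open ≡.≡-Reasoning
      fuel′ = fueled-parent uc fuel
      u′ = transport b f u
      c′ = matchChild u u′ c

    transport-adjacent-child : ∀ {u c} → Descendant a u → child u c ≡ true →
                               A (transport b (suc N) u) (transport b (suc N) c) ≡ true
    transport-adjacent-child {u} {c} du uc
      rewrite transport-child b N uc | transport-refuel du (fueled-parent uc (fueled c)) =
      ∧-conicalˡ _ _ (proj₁ (matchChild-correct (proj₂ (transport-correct du fuel)) uc))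
      where
      fuel : Fueled u N
      fuel = fueled-parent uc (fueled c)

    transport-adjacent : ∀ {u v} → Descendant a u → Descendant a v → A u v ≡ true →
                         A (transport b (suc N) u) (transport b (suc N) v) ≡ true
    transport-adjacent du dv uv with descendants-adjacent a∈K du dv uv
    ... | inj₁ uv′ = transport-adjacent-child du uv′
    ... | inj₂ vu′ = trans (Graph.sym F _ _) (transport-adjacent-child dv vu′)

  sameColor⇒iso : ∀ {x y} → x ∈ K → y ∈ K → E x y ≡ true → RootedIso F F K K x y
  sameColor⇒iso {x} {y} x∈K y∈K xy = record
    { to       = τ
    ; from     = σ
    ; to-in    = λ u tu → Descendant⇒InTree (proj₁ (X.transport-correct (desc-x tu) (fueled u)))
    ; from-in  = λ v tv → Descendant⇒InTree (proj₁ (Y.transport-correct (desc-y tv) (fueled v)))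
    ; from-to  = λ u tu → X.transport-inverse (desc-x tu) (fueled u)
    ; to-from  = λ v tv → Y.transport-inverse (desc-y tv) (fueled v)
    ; root↦    = transport-core y N x∈K
    ; adj-pres = λ u v tu tv → bool-ext (X.transport-adjacent (desc-x tu) (desc-x tv))
        (λ τuτv → subst₂ (λ u′ v′ → A u′ v′ ≡ true)
          (X.transport-inverse (desc-x tu) (fueled u)) (X.transport-inverse (desc-x tv) (fueled v))
          (Y.transport-adjacent (image tu) (image tv) τuτv))
    }
    where
    τ σ : V → V
    τ = transport y (suc N)
    σ = transport x (suc N)
    module X = Transport x∈K y∈K xy
    module Y = Transport y∈K x∈K (E.sym xy)
    desc-x : ∀ {u} → InTree F K x u → Descendant x u
    desc-x = InTree⇒Descendant x∈K
    desc-y : ∀ {v} → InTree F K y v → Descendant y v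
    desc-y = InTree⇒Descendant y∈K
    image : ∀ {u} → InTree F K x u → Descendant y (τ u)
    image {u} tu = proj₁ (X.transport-correct (desc-x tu) (fueled u))

sameStableColor⇒iso : ∀ (F : Graph) {K} → IsCore F K → ∀ {x y} → x ∈ K → y ∈ K →
                      SameStableColor F x y → RootedIso F F K K x y
sameStableColor⇒iso F isCore x∈K y∈K same
  with Peeling.peeling-stabilises F | ColourRefinement.sameColor-stabilises F
... | N , N-stable | M , M-stable =
  StableColourTrees.sameColor⇒iso F isCore N N-stable M M-stable x∈K y∈K (same M)

record ComponentEmbedding (G F : Graph) (KG : Subset (n G)) (KF : Subset (n F)) : Set where
  field
    embed         : Fin (n G) → Fin (n F)
    unembed       : Fin (n F) → Maybe (Fin (n G))
    unembed-embed : ∀ u → unembed (embed u) ≡ just u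
    adj-embed     : ∀ u v → adj F (embed u) (embed v) ≡ adj G u v
    adj-closed    : ∀ u w → adj F (embed u) w ≡ true → ∃ λ v → embed v ≡ w
    core-embed⁺   : ∀ {u} → u ∈ KG → embed u ∈ KF
    core-embed⁻   : ∀ {u} → embed u ∈ KF → u ∈ KG

module _ {G F KG KF} (ι : ComponentEmbedding G F KG KF) {x : Fin (n G)} where
  open ComponentEmbedding ι

  InTree-embed : ∀ {u} → InTree G KG x u → InTree F KF (embed x) (embed u)
  InTree-embed root             = root
  InTree-embed (step t uw w∉KG) = step (InTree-embed t) (trans (adj-embed _ _) uw) (w∉KG ∘ core-embed⁻)

  InTree-unembed : ∀ {w} → InTree F KF (embed x) w → ∃ λ u → embed u ≡ w × InTree G KG x u
  InTree-unembed root = x , refl , root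
  InTree-unembed (step t uw w∉KF) with InTree-unembed t
  ... | u , refl , tu with adj-closed u _ uw
  ...   | v , refl = v , refl , step tu (trans (≡.sym (adj-embed u v)) uw) (w∉KF ∘ core-embed⁺)

restrict-iso : ∀ {G H F KG KH KF}
               (ιG : ComponentEmbedding G F KG KF) (ιH : ComponentEmbedding H F KH KF) {x y} →
               let open ComponentEmbedding in
               RootedIso F F KF KF (embed ιG x) (embed ιH y) → RootedIso G H KG KH x y
restrict-iso {G} {H} {F} {KG} {KH} {KF} ιG ιH {x} {y} R = record
  { to       = to
  ; from     = from
  ; to-in    = λ u tu → proj₂ (to-embed tu)
  ; from-in  = λ v tv → proj₂ (from-embed tv)
  ; from-to  = λ u tu → trans (cong (fromMaybe x ∘ G.unembed ∘ R.from) (≡.sym (proj₁ (to-embed tu))))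
                         (trans (cong (fromMaybe x ∘ G.unembed) (R.from-to _ (InTree-embed ιG tu)))
                                (cong (fromMaybe x) (G.unembed-embed u)))
  ; to-from  = λ v tv → trans (cong (fromMaybe y ∘ H.unembed ∘ R.to) (≡.sym (proj₁ (from-embed tv))))
                         (trans (cong (fromMaybe y ∘ H.unembed) (R.to-from _ (InTree-embed ιH tv)))
                                (cong (fromMaybe y) (H.unembed-embed v)))
  ; root↦    = trans (cong (fromMaybe y ∘ H.unembed) R.root↦) (cong (fromMaybe y) (H.unembed-embed y))
  ; adj-pres = λ u v tu tv → begin
      adj G u v                               ≡⟨ ≡.sym (G.adj-embed u v) ⟩
      adj F (G.embed u) (G.embed v)           ≡⟨ R.adj-pres _ _ (InTree-embed ιG tu) (InTree-embed ιG tv) ⟩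
      adj F (R.to (G.embed u)) (R.to (G.embed v))
        ≡⟨ cong₂ (adj F) (proj₁ (to-embed tu)) (proj₁ (to-embed tv)) ⟩
      adj F (H.embed (to u)) (H.embed (to v)) ≡⟨ H.adj-embed (to u) (to v) ⟩
      adj H (to u) (to v)                     ∎
  }
  where
  open ≡.≡-Reasoning
  module G = ComponentEmbedding ιG
  module H = ComponentEmbedding ιH
  module R = RootedIso R
  to : Fin (n G) → Fin (n H)
  to u = fromMaybe y (H.unembed (R.to (G.embed u)))
  from : Fin (n H) → Fin (n G)
  from v = fromMaybe x (G.unembed (R.from (H.embed v)))
  to-embed : ∀ {u} → InTree G KG x u → R.to (G.embed u) ≡ H.embed (to u) × InTree H KH y (to u)
  to-embed tu with InTree-unembed ιH (R.to-in _ (InTree-embed ιG tu))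
  ... | v , e , tv rewrite ≡.sym e | H.unembed-embed v = refl , tv
  from-embed : ∀ {v} → InTree H KH y v →
               R.from (H.embed v) ≡ G.embed (from v) × InTree G KG x (from v)
  from-embed tv with InTree-unembed ιG (R.from-in _ (InTree-embed ιH tv))
  ... | u , e , tu rewrite ≡.sym e | G.unembed-embed u = refl , tu

data Summand (m k : ℕ) : Fin (m + k) → Set where
  left  : ∀ u → Summand m k (u ↑ˡ k)
  right : ∀ v → Summand m k (m ↑ʳ v)

summand : ∀ m k a → Summand m k a
summand m k a with splitAt m a in split
... | inj₁ u = subst (Summand m k) (splitAt⁻¹-↑ˡ split) (left u)
... | inj₂ v = subst (Summand m k) (splitAt⁻¹-↑ʳ split) (right v)

module DisjointUnion (G H : Graph) where

  private
    nG = n G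
    nH = n H

  ⊕-adjˡˡ : ∀ u v → adj (G ⊕ H) (u ↑ˡ nH) (v ↑ˡ nH) ≡ adj G u v
  ⊕-adjˡˡ u v rewrite splitAt-↑ˡ nG u nH | splitAt-↑ˡ nG v nH = refl

  ⊕-adjˡʳ : ∀ u v → adj (G ⊕ H) (u ↑ˡ nH) (nG ↑ʳ v) ≡ false
  ⊕-adjˡʳ u v rewrite splitAt-↑ˡ nG u nH | splitAt-↑ʳ nG nH v = refl

  ⊕-adjʳˡ : ∀ u v → adj (G ⊕ H) (nG ↑ʳ u) (v ↑ˡ nH) ≡ false
  ⊕-adjʳˡ u v rewrite splitAt-↑ʳ nG nH u | splitAt-↑ˡ nG v nH = refl

  ⊕-adjʳʳ : ∀ u v → adj (G ⊕ H) (nG ↑ʳ u) (nG ↑ʳ v) ≡ adj H u v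
  ⊕-adjʳʳ u v rewrite splitAt-↑ʳ nG nH u | splitAt-↑ʳ nG nH v = refl

  leftPart : Subset (nG + nH) → Subset nG
  leftPart S = tabulate (λ u → lookup S (u ↑ˡ nH))

  rightPart : Subset (nG + nH) → Subset nH
  rightPart S = tabulate (λ v → lookup S (nG ↑ʳ v))

  leftPart-++ : ∀ P Q → leftPart (P ++ Q) ≡ P
  leftPart-++ P Q = trans (tabulate-cong (λ u → lookup-++ˡ P Q u)) (tabulate∘lookup P)

  rightPart-++ : ∀ P Q → rightPart (P ++ Q) ≡ Q
  rightPart-++ P Q = trans (tabulate-cong (λ v → lookup-++ʳ P Q v)) (tabulate∘lookup Q)

  ∣nbhd-↑ˡ∩∣ : ∀ u S → ∣ nbhd (G ⊕ H) (u ↑ˡ nH) ∩ S ∣ ≡ ∣ nbhd G u ∩ leftPart S ∣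
  ∣nbhd-↑ˡ∩∣ u S = begin
    ∣ nbhd (G ⊕ H) (u ↑ˡ nH) ∩ S ∣                                        ≡⟨ ∣tabulate∩∣ _ S ⟩
    count (λ w → adj (G ⊕ H) (u ↑ˡ nH) w ∧ lookup S w)                     ≡⟨ count-↑ nG nH _ ⟩
    count (λ w → adj (G ⊕ H) (u ↑ˡ nH) (w ↑ˡ nH) ∧ lookup S (w ↑ˡ nH)) +
    count (λ w → adj (G ⊕ H) (u ↑ˡ nH) (nG ↑ʳ w) ∧ lookup S (nG ↑ʳ w))
      ≡⟨ cong₂ _+_ (count-cong λ w → cong₂ _∧_ (⊕-adjˡˡ u w) (≡.sym (lookup∘tabulate _ w)))
                   (count-none λ w → cong (_∧ _) (⊕-adjˡʳ u w)) ⟩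
    count (λ w → adj G u w ∧ lookup (leftPart S) w) + 0                    ≡⟨ +-identityʳ _ ⟩
    count (λ w → adj G u w ∧ lookup (leftPart S) w)
      ≡⟨ ≡.sym (∣tabulate∩∣ (adj G u) (leftPart S)) ⟩
    ∣ nbhd G u ∩ leftPart S ∣                                               ∎
    where open ≡.≡-Reasoning

  ∣nbhd-↑ʳ∩∣ : ∀ v S → ∣ nbhd (G ⊕ H) (nG ↑ʳ v) ∩ S ∣ ≡ ∣ nbhd H v ∩ rightPart S ∣
  ∣nbhd-↑ʳ∩∣ v S = begin
    ∣ nbhd (G ⊕ H) (nG ↑ʳ v) ∩ S ∣                                        ≡⟨ ∣tabulate∩∣ _ S ⟩
    count (λ w → adj (G ⊕ H) (nG ↑ʳ v) w ∧ lookup S w)                     ≡⟨ count-↑ nG nH _ ⟩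
    count (λ w → adj (G ⊕ H) (nG ↑ʳ v) (w ↑ˡ nH) ∧ lookup S (w ↑ˡ nH)) +
    count (λ w → adj (G ⊕ H) (nG ↑ʳ v) (nG ↑ʳ w) ∧ lookup S (nG ↑ʳ w))
      ≡⟨ cong₂ _+_ (count-none λ w → cong (_∧ _) (⊕-adjʳˡ v w))
                   (count-cong λ w → cong₂ _∧_ (⊕-adjʳʳ v w) (≡.sym (lookup∘tabulate _ w))) ⟩
    0 + count (λ w → adj H v w ∧ lookup (rightPart S) w)
      ≡⟨ ≡.sym (∣tabulate∩∣ (adj H v) (rightPart S)) ⟩
    ∣ nbhd H v ∩ rightPart S ∣                                              ∎
    where open ≡.≡-Reasoning

  ↑ˡ∈⇒∈leftPart : ∀ {S u} → u ↑ˡ nH ∈ S → u ∈ leftPart S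
  ↑ˡ∈⇒∈leftPart = ∈-tabulate⁺ ∘ []=⇒lookup

  ∈leftPart⇒↑ˡ∈ : ∀ {S u} → u ∈ leftPart S → u ↑ˡ nH ∈ S
  ∈leftPart⇒↑ˡ∈ = lookup⇒[]= _ _ ∘ ∈-tabulate⁻

  ↑ʳ∈⇒∈rightPart : ∀ {S v} → nG ↑ʳ v ∈ S → v ∈ rightPart S
  ↑ʳ∈⇒∈rightPart = ∈-tabulate⁺ ∘ []=⇒lookup

  ∈rightPart⇒↑ʳ∈ : ∀ {S v} → v ∈ rightPart S → nG ↑ʳ v ∈ S
  ∈rightPart⇒↑ʳ∈ = lookup⇒[]= _ _ ∘ ∈-tabulate⁻

  ↑ˡ∈++⇔∈ : ∀ {P Q u} → (u ↑ˡ nH ∈ P ++ Q → u ∈ P) × (u ∈ P → u ↑ˡ nH ∈ P ++ Q)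
  ↑ˡ∈++⇔∈ {P} {Q} = subst (_ ∈_) (leftPart-++ P Q) ∘ ↑ˡ∈⇒∈leftPart
                  , ∈leftPart⇒↑ˡ∈ ∘ subst (_ ∈_) (≡.sym (leftPart-++ P Q))

  ↑ʳ∈++⇔∈ : ∀ {P Q v} → (nG ↑ʳ v ∈ P ++ Q → v ∈ Q) × (v ∈ Q → nG ↑ʳ v ∈ P ++ Q)
  ↑ʳ∈++⇔∈ {P} {Q} = subst (_ ∈_) (rightPart-++ P Q) ∘ ↑ʳ∈⇒∈rightPart
                  , ∈rightPart⇒↑ʳ∈ ∘ subst (_ ∈_) (≡.sym (rightPart-++ P Q))

  leftPart-minDeg2 : ∀ {S} → MinDeg2 (G ⊕ H) S → MinDeg2 G (leftPart S)
  leftPart-minDeg2 {S} minDeg u u∈ = subst (2 ≤_) (∣nbhd-↑ˡ∩∣ u S) (minDeg _ (∈leftPart⇒↑ˡ∈ u∈))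

  rightPart-minDeg2 : ∀ {S} → MinDeg2 (G ⊕ H) S → MinDeg2 H (rightPart S)
  rightPart-minDeg2 {S} minDeg v v∈ = subst (2 ≤_) (∣nbhd-↑ʳ∩∣ v S) (minDeg _ (∈rightPart⇒↑ʳ∈ v∈))

  ⊕-minDeg2 : ∀ {P Q} → MinDeg2 G P → MinDeg2 H Q → MinDeg2 (G ⊕ H) (P ++ Q)
  ⊕-minDeg2 {P} {Q} minDegP minDegQ a a∈ with summand nG nH a
  ... | left u  = subst (2 ≤_) (≡.sym (trans (∣nbhd-↑ˡ∩∣ u (P ++ Q)) (cong (∣_∣ ∘ (nbhd G u ∩_)) (leftPart-++ P Q))))
                    (minDegP u (proj₁ ↑ˡ∈++⇔∈ a∈))
  ... | right v = subst (2 ≤_) (≡.sym (trans (∣nbhd-↑ʳ∩∣ v (P ++ Q)) (cong (∣_∣ ∘ (nbhd H v ∩_)) (rightPart-++ P Q))))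
                    (minDegQ v (proj₁ ↑ʳ∈++⇔∈ a∈))

  ⊕-core : ∀ {KG KH} → IsCore G KG → IsCore H KH → IsCore (G ⊕ H) (KG ++ KH)
  ⊕-core (minDegG , maximalG) (minDegH , maximalH) = ⊕-minDeg2 minDegG minDegH , maximal
    where
    maximal : ∀ S → MinDeg2 (G ⊕ H) S → S ⊆ _
    maximal S minDeg {a} a∈ with summand nG nH a
    ... | left u  = proj₂ ↑ˡ∈++⇔∈ (maximalG (leftPart S) (leftPart-minDeg2 minDeg) (↑ˡ∈⇒∈leftPart a∈))
    ... | right v = proj₂ ↑ʳ∈++⇔∈ (maximalH (rightPart S) (rightPart-minDeg2 minDeg) (↑ʳ∈⇒∈rightPart a∈))

  ↑ˡ-component : ∀ {KG KH} → ComponentEmbedding G (G ⊕ H) KG (KG ++ KH)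
  ↑ˡ-component = record
    { embed         = _↑ˡ nH
    ; unembed       = λ a → [ just , (λ _ → nothing) ]′ (splitAt nG a)
    ; unembed-embed = λ u → cong [ just , (λ _ → nothing) ]′ (splitAt-↑ˡ nG u nH)
    ; adj-embed     = ⊕-adjˡˡ
    ; adj-closed    = closed
    ; core-embed⁺   = proj₂ ↑ˡ∈++⇔∈
    ; core-embed⁻   = proj₁ ↑ˡ∈++⇔∈
    }
    where
    closed : ∀ u w → adj (G ⊕ H) (u ↑ˡ nH) w ≡ true → ∃ λ v → v ↑ˡ nH ≡ w
    closed u w uw with summand nG nH w
    ... | left v  = v , refl
    ... | right v = ⊥-elim (true≢false uw (⊕-adjˡʳ u v))

  ↑ʳ-component : ∀ {KG KH} → ComponentEmbedding H (G ⊕ H) KH (KG ++ KH)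
  ↑ʳ-component = record
    { embed         = nG ↑ʳ_
    ; unembed       = λ a → [ (λ _ → nothing) , just ]′ (splitAt nG a)
    ; unembed-embed = λ v → cong [ (λ _ → nothing) , just ]′ (splitAt-↑ʳ nG nH v)
    ; adj-embed     = ⊕-adjʳʳ
    ; adj-closed    = closed
    ; core-embed⁺   = proj₂ ↑ʳ∈++⇔∈
    ; core-embed⁻   = proj₁ ↑ʳ∈++⇔∈
    }
    where
    closed : ∀ v w → adj (G ⊕ H) (nG ↑ʳ v) w ≡ true → ∃ λ u → nG ↑ʳ u ≡ w
    closed v w vw with summand nG nH w
    ... | left u  = ⊥-elim (true≢false vw (⊕-adjʳˡ v u))
    ... | right u = u , refl

sameStableColor-⊕⇒iso : ∀ {G H KG KH x y} → IsCore G KG → IsCore H KH → x ∈ KG → y ∈ KH →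
                        SameStableColor (G ⊕ H) (x ↑ˡ n H) (n G ↑ʳ y) → RootedIso G H KG KH x y
sameStableColor-⊕⇒iso {G} {H} coreG coreH x∈KG y∈KH same =
  restrict-iso ↑ˡ-component ↑ʳ-component
    (sameStableColor⇒iso (G ⊕ H) (⊕-core coreG coreH)
      (proj₂ ↑ˡ∈++⇔∈ x∈KG) (proj₂ ↑ʳ∈++⇔∈ y∈KH) same)
  where open DisjointUnion G H

claim3 : (∀ (G H : Graph) (KG : Subset (n G)) (KH : Subset (n H))
    (x : Fin (n G)) (y : Fin (n H)) →
    IsCore G KG → IsCore H KH → x ∈ KG → y ∈ KH →
    ¬ RootedIso G H KG KH x y →
    ¬ SameStableColor (G ⊕ H) (x ↑ˡ n H) (n G ↑ʳ y))
    × (∀ (G : Graph) (K : Subset (n G)) (x y : Fin (n G)) →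
    IsCore G K → x ∈ K → y ∈ K →
    ¬ RootedIso G G K K x y →
    ¬ SameStableColor G x y)
claim3 =
    (λ G H KG KH x y coreG coreH x∈KG y∈KH ¬iso →
       ¬iso ∘ sameStableColor-⊕⇒iso coreG coreH x∈KG y∈KH)
  , (λ G K x y core x∈K y∈K ¬iso → ¬iso ∘ sameStableColor⇒iso G core x∈K y∈K)
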